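{- (1) There exists a first-order formula $F$ such that $\mathsf{CL} \vdash \neg F$ but $\mathsf{IL} \nvdash \neg F$. (2) For any formula $F$ with $\mathsf{CL} \vdash \neg F$ and $\mathsf{IL} \nvdash \neg F$, there is no formula $B$ in the negative fragment $\mathsf{NF}$ such that $\mathsf{IL} \vdash F \leftrightarrow B$.
   Context: $\mathsf{CL}$ is pure first-order classical predicate logic based on the connectives $\bot, \wedge, \vee, \to, \forall, \exists$ (with $\neg A$ abbreviating $A \to \bot$ and $A \leftrightarrow B$ abbreviating $(A\to B)\wedge(B\to A)$); $\mathsf{IL}$ is its intuitionistic counterpart. All formulas are in this common language. The negative fragment $\mathsf{NF}$ is the set of formulas inductively generated by: $\bot \in \mathsf{NF}$; $\neg P \in \mathsf{NF}$ for every atomic formula $P$; if $A, B \in \mathsf{NF}$ then $A \wedge B$, $A \to B$, $\forall x A \in \mathsf{NF}$. -}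

module Defs where

open import Data.Nat using (ℕ; zero; suc)
open import Data.List using (List; []; _∷_; map)
open import Data.List.Membership.Propositional using (_∈_)

-- Pure first-order language: no function symbols, no constants, no equality.
-- Terms are variables (de Bruijn indices, an infinite supply).
-- Predicate symbols: `atom p ts` applies the symbol named p (of arity length ts)
-- to the variable list ts.

infixr 6 _∧'_
infixr 5 _∨'_
infixr 4 _⇒_

data Fm : Set where
  atom : ℕ → List ℕ → Fm
  ⊥'   : Fm
  _∧'_ : Fm → Fm → Fm
  _∨'_ : Fm → Fm → Fm
  _⇒_  : Fm → Fm → Fm
  ∀'   : Fm → Fm
  ∃'   : Fm → Fm

¬' : Fm → Fm
¬' A = A ⇒ ⊥'

_⇔_ : Fm → Fm → Fm
A ⇔ B = (A ⇒ B) ∧' (B ⇒ A)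

-- renaming of variables (= substitution, since terms are variables)
lift : (ℕ → ℕ) → ℕ → ℕ
lift ρ zero    = zero
lift ρ (suc i) = suc (ρ i)

ren : (ℕ → ℕ) → Fm → Fm
ren ρ (atom p ts) = atom p (map ρ ts)
ren ρ ⊥'          = ⊥'
ren ρ (A ∧' B)    = ren ρ A ∧' ren ρ B
ren ρ (A ∨' B)    = ren ρ A ∨' ren ρ B
ren ρ (A ⇒ B)     = ren ρ A ⇒ ren ρ B
ren ρ (∀' A)      = ∀' (ren (lift ρ) A)
ren ρ (∃' A)      = ∃' (ren (lift ρ) A)

wk : Fm → Fm
wk = ren suc

sub0 : ℕ → ℕ → ℕ
sub0 t zero    = t
sub0 t (suc i) = i

_[_] : Fm → ℕ → Fm
A [ t ] = ren (sub0 t) A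

data Logic : Set where
  IL CL : Logic

infix 2 _∣_⊢_
data _∣_⊢_ : Logic → List Fm → Fm → Set where
  hyp   : ∀ {L Γ A} → A ∈ Γ → L ∣ Γ ⊢ A
  ⊥E    : ∀ {L Γ A} → L ∣ Γ ⊢ ⊥' → L ∣ Γ ⊢ A
  raa   : ∀ {Γ A} → CL ∣ ¬' A ∷ Γ ⊢ ⊥' → CL ∣ Γ ⊢ A
  ∧I    : ∀ {L Γ A B} → L ∣ Γ ⊢ A → L ∣ Γ ⊢ B → L ∣ Γ ⊢ A ∧' B
  ∧E₁   : ∀ {L Γ A B} → L ∣ Γ ⊢ A ∧' B → L ∣ Γ ⊢ A
  ∧E₂   : ∀ {L Γ A B} → L ∣ Γ ⊢ A ∧' B → L ∣ Γ ⊢ B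
  ∨I₁   : ∀ {L Γ A B} → L ∣ Γ ⊢ A → L ∣ Γ ⊢ A ∨' B
  ∨I₂   : ∀ {L Γ A B} → L ∣ Γ ⊢ B → L ∣ Γ ⊢ A ∨' B
  ∨E    : ∀ {L Γ A B C} → L ∣ Γ ⊢ A ∨' B → L ∣ A ∷ Γ ⊢ C → L ∣ B ∷ Γ ⊢ C → L ∣ Γ ⊢ C
  ⇒I    : ∀ {L Γ A B} → L ∣ A ∷ Γ ⊢ B → L ∣ Γ ⊢ A ⇒ B
  ⇒E    : ∀ {L Γ A B} → L ∣ Γ ⊢ A ⇒ B → L ∣ Γ ⊢ A → L ∣ Γ ⊢ B
  ∀I    : ∀ {L Γ A} → L ∣ map wk Γ ⊢ A → L ∣ Γ ⊢ ∀' A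
  ∀E    : ∀ {L Γ A} → L ∣ Γ ⊢ ∀' A → (t : ℕ) → L ∣ Γ ⊢ A [ t ]
  ∃I    : ∀ {L Γ A} (t : ℕ) → L ∣ Γ ⊢ A [ t ] → L ∣ Γ ⊢ ∃' A
  ∃E    : ∀ {L Γ A C} → L ∣ Γ ⊢ ∃' A → L ∣ A ∷ map wk Γ ⊢ wk C → L ∣ Γ ⊢ C

_⊢_ : Logic → Fm → Set
L ⊢ A = L ∣ [] ⊢ A

data NF : Fm → Set where
  nf⊥   : NF ⊥'
  nf¬at : ∀ p ts → NF (¬' (atom p ts))
  nf∧   : ∀ {A B} → NF A → NF B → NF (A ∧' B)
  nf⇒   : ∀ {A B} → NF A → NF B → NF (A ⇒ B)
  nf∀   : ∀ {A} → NF A → NF (∀' A)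

-- CL ⊢ ¬(∀x¬¬Px ∧ ¬∀xPx) since ∀x¬¬Px classically gives ∀xPx, but the
-- formula is forced at the root of the Kripke model on worlds ℕ in which
-- P d holds at w exactly when d < w: at every world each d eventually
-- satisfies P, yet no world satisfies P of everything.
--
-- For (2), the Gödel–Gentzen translation N satisfies CL ⊢ A ⇒ IL ⊢ N A, and
-- on the negative fragment IL ⊢ B ⇔ N B.  So from CL ⊢ ¬F and IL ⊢ F ⇔ B we
-- get CL ⊢ ¬B, hence IL ⊢ N(¬B) = ¬ N B, hence IL ⊢ ¬B and IL ⊢ ¬F.
module Submission where

open import Defs
open import Data.Empty using (⊥; ⊥-elim)
open import Data.List using (List; []; _∷_; map)
open import Data.List.Properties using (map-∘; map-cong; map-id)
open import Data.List.Membership.Propositional.Properties using (∈-map⁺)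
open import Data.List.Relation.Binary.Subset.Propositional using (_⊆_)
open import Data.List.Relation.Binary.Subset.Propositional.Properties
  using (map⁺; xs⊆x∷xs; ∷⁺ʳ)
open import Data.List.Relation.Unary.All as All using (All; []; _∷_)
open import Data.List.Relation.Unary.All.Properties as All using ()
open import Data.List.Relation.Unary.Any using (here; there)
open import Data.Nat using (ℕ; zero; suc; _≤_; _<_; _+_)
open import Data.Nat.Properties using (≤-refl; ≤-trans; <-≤-trans; <-irrefl; m≤m+n; m≤n+m)
open import Data.Product as Product using (Σ; _×_; _,_)
open import Data.Sum as Sum using (_⊎_; [_,_])
open import Function using (id; _∘_)
open import Function.Bundles using (mk⇔; module Equivalence) renaming (_⇔_ to _⟺_)
open import Relation.Binary.PropositionalEquality
  using (_≡_; _≗_; refl; sym; trans; cong; cong₂; subst; subst₂)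
open import Relation.Nullary using (¬_)

open Equivalence using (to; from)

private
  variable
    L : Logic
    Γ Δ : List Fm
    A B C : Fm

lift-fuse : ∀ {ρ σ τ : ℕ → ℕ} → ρ ∘ σ ≗ τ → lift ρ ∘ lift σ ≗ lift τ
lift-fuse h zero    = refl
lift-fuse h (suc i) = cong suc (h i)

lift-id : ∀ {τ : ℕ → ℕ} → τ ≗ id → lift τ ≗ id
lift-id h zero    = refl
lift-id h (suc i) = cong suc (h i)

ren-fuse : ∀ A {ρ σ τ : ℕ → ℕ} → ρ ∘ σ ≗ τ → ren ρ (ren σ A) ≡ ren τ A
ren-fuse (atom p ts) h = cong (atom p) (trans (sym (map-∘ ts)) (map-cong h ts))
ren-fuse ⊥'          h = refl
ren-fuse (A ∧' B)    h = cong₂ _∧'_ (ren-fuse A h) (ren-fuse B h)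
ren-fuse (A ∨' B)    h = cong₂ _∨'_ (ren-fuse A h) (ren-fuse B h)
ren-fuse (A ⇒ B)     h = cong₂ _⇒_ (ren-fuse A h) (ren-fuse B h)
ren-fuse (∀' A)      h = cong ∀' (ren-fuse A (lift-fuse h))
ren-fuse (∃' A)      h = cong ∃' (ren-fuse A (lift-fuse h))

ren-id : ∀ A {τ : ℕ → ℕ} → τ ≗ id → ren τ A ≡ A
ren-id (atom p ts) h = cong (atom p) (trans (map-cong h ts) (map-id ts))
ren-id ⊥'          h = refl
ren-id (A ∧' B)    h = cong₂ _∧'_ (ren-id A h) (ren-id B h)
ren-id (A ∨' B)    h = cong₂ _∨'_ (ren-id A h) (ren-id B h)
ren-id (A ⇒ B)     h = cong₂ _⇒_ (ren-id A h) (ren-id B h)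
ren-id (∀' A)      h = cong ∀' (ren-id A (lift-id h))
ren-id (∃' A)      h = cong ∃' (ren-id A (lift-id h))

ren-lift-suc-[0] : ∀ A → ren (lift suc) A [ 0 ] ≡ A
ren-lift-suc-[0] A = trans (ren-fuse A sub0-lift) (ren-id A λ _ → refl)
  where
  sub0-lift : sub0 0 ∘ lift suc ≗ id
  sub0-lift zero    = refl
  sub0-lift (suc i) = refl

⊢-mono : Γ ⊆ Δ → L ∣ Γ ⊢ A → L ∣ Δ ⊢ A
⊢-mono s (hyp x)    = hyp (s x)
⊢-mono s (⊥E d)     = ⊥E (⊢-mono s d)
⊢-mono s (raa d)    = raa (⊢-mono (∷⁺ʳ _ s) d)
⊢-mono s (∧I d e)   = ∧I (⊢-mono s d) (⊢-mono s e)
⊢-mono s (∧E₁ d)    = ∧E₁ (⊢-mono s d)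
⊢-mono s (∧E₂ d)    = ∧E₂ (⊢-mono s d)
⊢-mono s (∨I₁ d)    = ∨I₁ (⊢-mono s d)
⊢-mono s (∨I₂ d)    = ∨I₂ (⊢-mono s d)
⊢-mono s (∨E d e f) = ∨E (⊢-mono s d) (⊢-mono (∷⁺ʳ _ s) e) (⊢-mono (∷⁺ʳ _ s) f)
⊢-mono s (⇒I d)     = ⇒I (⊢-mono (∷⁺ʳ _ s) d)
⊢-mono s (⇒E d e)   = ⇒E (⊢-mono s d) (⊢-mono s e)
⊢-mono s (∀I d)     = ∀I (⊢-mono (map⁺ wk s) d)
⊢-mono s (∀E d t)   = ∀E (⊢-mono s d) t
⊢-mono s (∃I t d)   = ∃I t (⊢-mono s d)
⊢-mono s (∃E d e)   = ∃E (⊢-mono s d) (⊢-mono (∷⁺ʳ _ (map⁺ wk s)) e)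

weaken : L ∣ Γ ⊢ A → L ∣ B ∷ Γ ⊢ A
weaken = ⊢-mono (xs⊆x∷xs _ _)

weaken-under : L ∣ C ∷ Γ ⊢ A → L ∣ C ∷ B ∷ Γ ⊢ A
weaken-under = ⊢-mono (∷⁺ʳ _ (xs⊆x∷xs _ _))

#0 : L ∣ A ∷ Γ ⊢ A
#0 = hyp (here refl)

#1 : L ∣ B ∷ A ∷ Γ ⊢ A
#1 = hyp (there (here refl))

inst₀ : ∀ A → L ∣ wk (∀' A) ∷ Γ ⊢ A
inst₀ {L = L} {Γ = Γ} A = subst (L ∣ wk (∀' A) ∷ Γ ⊢_) (ren-lift-suc-[0] A) (∀E #0 0)

IL-to-CL : IL ∣ Γ ⊢ A → CL ∣ Γ ⊢ A
IL-to-CL (hyp x)    = hyp x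
IL-to-CL (⊥E d)     = ⊥E (IL-to-CL d)
IL-to-CL (∧I d e)   = ∧I (IL-to-CL d) (IL-to-CL e)
IL-to-CL (∧E₁ d)    = ∧E₁ (IL-to-CL d)
IL-to-CL (∧E₂ d)    = ∧E₂ (IL-to-CL d)
IL-to-CL (∨I₁ d)    = ∨I₁ (IL-to-CL d)
IL-to-CL (∨I₂ d)    = ∨I₂ (IL-to-CL d)
IL-to-CL (∨E d e f) = ∨E (IL-to-CL d) (IL-to-CL e) (IL-to-CL f)
IL-to-CL (⇒I d)     = ⇒I (IL-to-CL d)
IL-to-CL (⇒E d e)   = ⇒E (IL-to-CL d) (IL-to-CL e)
IL-to-CL (∀I d)     = ∀I (IL-to-CL d)
IL-to-CL (∀E d t)   = ∀E (IL-to-CL d) t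
IL-to-CL (∃I t d)   = ∃I t (IL-to-CL d)
IL-to-CL (∃E d e)   = ∃E (IL-to-CL d) (IL-to-CL e)

¬¬-intro : L ∣ Γ ⊢ A ⇒ ¬' (¬' A)
¬¬-intro = ⇒I (⇒I (⇒E #0 #1))

¬¬¬⇒¬ : ∀ A → L ∣ Γ ⊢ ¬' (¬' (¬' A)) ⇒ ¬' A
¬¬¬⇒¬ A = ⇒I (⇒I (⇒E #1 (⇒I (⇒E #0 #1))))

¬¬-map : L ∣ Γ ⊢ ¬' (¬' A) → L ∣ A ∷ Γ ⊢ B → L ∣ Γ ⊢ ¬' (¬' B)
¬¬-map d e = ⇒I (⇒E (weaken d) (⇒I (⇒E #1 (weaken-under e))))

contrapose : L ∣ Γ ⊢ A ⇒ B → L ∣ Γ ⊢ ¬' B → L ∣ Γ ⊢ ¬' A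
contrapose d e = ⇒I (⇒E (weaken e) (⇒E (weaken d) #0))

N : Fm → Fm
N (atom p ts) = ¬' (¬' (atom p ts))
N ⊥'          = ⊥'
N (A ∧' B)    = N A ∧' N B
N (A ∨' B)    = ¬' (¬' (N A) ∧' ¬' (N B))
N (A ⇒ B)     = N A ⇒ N B
N (∀' A)      = ∀' (N A)
N (∃' A)      = ¬' (∀' (¬' (N A)))

N-ren : ∀ A (σ : ℕ → ℕ) → N (ren σ A) ≡ ren σ (N A)
N-ren (atom p ts) σ = refl
N-ren ⊥'          σ = refl
N-ren (A ∧' B)    σ = cong₂ _∧'_ (N-ren A σ) (N-ren B σ)
N-ren (A ∨' B)    σ = cong₂ (λ X Y → ¬' (¬' X ∧' ¬' Y)) (N-ren A σ) (N-ren B σ)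
N-ren (A ⇒ B)     σ = cong₂ _⇒_ (N-ren A σ) (N-ren B σ)
N-ren (∀' A)      σ = cong ∀' (N-ren A (lift σ))
N-ren (∃' A)      σ = cong (λ X → ¬' (∀' (¬' X))) (N-ren A (lift σ))

N-map-wk : ∀ Γ → map N (map wk Γ) ≡ map wk (map N Γ)
N-map-wk Γ = trans (sym (map-∘ Γ)) (trans (map-cong (λ A → N-ren A suc) Γ) (map-∘ Γ))

N-stable : ∀ A → L ∣ Γ ⊢ ¬' (¬' (N A)) ⇒ N A
N-stable (atom p ts) = ¬¬¬⇒¬ (¬' (atom p ts))
N-stable ⊥'          = ⇒I (⇒E #0 (⇒I #0))
N-stable (A ∧' B)    = ⇒I (∧I (⇒E (N-stable A) (¬¬-map #0 (∧E₁ #0)))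
                              (⇒E (N-stable B) (¬¬-map #0 (∧E₂ #0))))
N-stable (A ∨' B)    = ¬¬¬⇒¬ (¬' (N A) ∧' ¬' (N B))
N-stable (A ⇒ B)     = ⇒I (⇒I (⇒E (N-stable B) (¬¬-map #1 (⇒E #0 #1))))
N-stable (∀' A)      = ⇒I (∀I (⇒E (N-stable A) (¬¬-map #0 (inst₀ (N A)))))
N-stable (∃' A)      = ¬¬¬⇒¬ (∀' (¬' (N A)))

N-raa : ∀ A → L ∣ ¬' (N A) ∷ Γ ⊢ ⊥' → L ∣ Γ ⊢ N A
N-raa A d = ⇒E (N-stable A) (⇒I d)

CL-to-IL-N : CL ∣ Γ ⊢ A → IL ∣ map N Γ ⊢ N A
CL-to-IL-N (hyp x)              = hyp (∈-map⁺ N x)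
CL-to-IL-N (⊥E d)               = ⊥E (CL-to-IL-N d)
CL-to-IL-N {A = A} (raa d)      = N-raa A (CL-to-IL-N d)
CL-to-IL-N (∧I d e)             = ∧I (CL-to-IL-N d) (CL-to-IL-N e)
CL-to-IL-N (∧E₁ d)              = ∧E₁ (CL-to-IL-N d)
CL-to-IL-N (∧E₂ d)              = ∧E₂ (CL-to-IL-N d)
CL-to-IL-N (∨I₁ d)              = ⇒I (⇒E (∧E₁ #0) (weaken (CL-to-IL-N d)))
CL-to-IL-N (∨I₂ d)              = ⇒I (⇒E (∧E₂ #0) (weaken (CL-to-IL-N d)))
CL-to-IL-N {A = C} (∨E d e f)   =
  N-raa C (⇒E (weaken (CL-to-IL-N d)) (∧I (⇒I (⇒E #1 (weaken-under (CL-to-IL-N e))))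
                                          (⇒I (⇒E #1 (weaken-under (CL-to-IL-N f))))))
CL-to-IL-N (⇒I d)               = ⇒I (CL-to-IL-N d)
CL-to-IL-N (⇒E d e)             = ⇒E (CL-to-IL-N d) (CL-to-IL-N e)
CL-to-IL-N {Γ} (∀I d)           = ∀I (subst (IL ∣_⊢ _) (N-map-wk Γ) (CL-to-IL-N d))
CL-to-IL-N (∀E {A = A} d t)     = subst (IL ∣ _ ⊢_) (sym (N-ren A (sub0 t))) (∀E (CL-to-IL-N d) t)
CL-to-IL-N (∃I {A = A} t d)     =
  ⇒I (⇒E (∀E #0 t) (weaken (subst (IL ∣ _ ⊢_) (N-ren A (sub0 t)) (CL-to-IL-N d))))
CL-to-IL-N {Γ} {C} (∃E {A = A} d e) =
  N-raa C (⇒E (weaken (CL-to-IL-N d)) (∀I (⇒I (⇒E #1 (weaken-under e′)))))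
  where
  e′ : IL ∣ N A ∷ map wk (map N Γ) ⊢ wk (N C)
  e′ = subst₂ (λ Δ X → IL ∣ N A ∷ Δ ⊢ X) (N-map-wk Γ) (N-ren C suc) (CL-to-IL-N e)

to-N   : NF B → L ∣ Γ ⊢ B ⇒ N B
from-N : NF B → L ∣ Γ ⊢ N B ⇒ B
to-N nf⊥            = ⇒I #0
to-N (nf¬at p ts)   = ¬¬-intro
to-N (nf∧ a b)      = ⇒I (∧I (⇒E (to-N a) (∧E₁ #0)) (⇒E (to-N b) (∧E₂ #0)))
to-N (nf⇒ a b)      = ⇒I (⇒I (⇒E (to-N b) (⇒E #1 (⇒E (from-N a) #0))))
to-N (nf∀ {B} a)    = ⇒I (∀I (⇒E (to-N a) (inst₀ B)))
from-N nf⊥          = ⇒I #0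
from-N (nf¬at p ts) = ¬¬¬⇒¬ (atom p ts)
from-N (nf∧ a b)    = ⇒I (∧I (⇒E (from-N a) (∧E₁ #0)) (⇒E (from-N b) (∧E₂ #0)))
from-N (nf⇒ a b)    = ⇒I (⇒I (⇒E (from-N b) (⇒E #1 (⇒E (to-N a) #0))))
from-N (nf∀ {B} a)  = ⇒I (∀I (⇒E (from-N a) (inst₀ (N B))))

CL-refutable-NF-is-IL-refutable : NF B → CL ⊢ ¬' B → IL ⊢ ¬' B
CL-refutable-NF-is-IL-refutable nfB cl = contrapose (to-N nfB) (CL-to-IL-N cl)

extend : ℕ → (ℕ → ℕ) → ℕ → ℕ
extend d ρ zero    = d
extend d ρ (suc i) = ρ i

-- The countermodel: worlds ℕ ordered by ≤, constant domain ℕ, and every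
-- predicate symbol holds at w of exactly the tuples with all entries below w.
force : ℕ → (ℕ → ℕ) → Fm → Set
force w ρ (atom p ts) = All (_< w) (map ρ ts)
force w ρ ⊥'          = ⊥
force w ρ (A ∧' B)    = force w ρ A × force w ρ B
force w ρ (A ∨' B)    = force w ρ A ⊎ force w ρ B
force w ρ (A ⇒ B)     = ∀ v → w ≤ v → force v ρ A → force v ρ B
force w ρ (∀' A)      = ∀ v → w ≤ v → ∀ d → force v (extend d ρ) A
force w ρ (∃' A)      = Σ ℕ λ d → force w (extend d ρ) A

force-mono : ∀ A {w v ρ} → w ≤ v → force w ρ A → force v ρ A
force-mono (atom p ts) w≤v = All.map (λ x<w → <-≤-trans x<w w≤v)
force-mono ⊥'          w≤v ()
force-mono (A ∧' B)    w≤v = Product.map (force-mono A w≤v) (force-mono B w≤v)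
force-mono (A ∨' B)    w≤v = Sum.map (force-mono A w≤v) (force-mono B w≤v)
force-mono (A ⇒ B)     w≤v f u v≤u = f u (≤-trans w≤v v≤u)
force-mono (∀' A)      w≤v f u v≤u = f u (≤-trans w≤v v≤u)
force-mono (∃' A)      w≤v = Product.map₂ (force-mono A w≤v)

extend-lift : ∀ {d} {ρ′ σ ρ : ℕ → ℕ} → ρ′ ∘ σ ≗ ρ → extend d ρ′ ∘ lift σ ≗ extend d ρ
extend-lift h zero    = refl
extend-lift h (suc i) = h i

extend-sub0 : ∀ (ρ : ℕ → ℕ) t → ρ ∘ sub0 t ≗ extend (ρ t) ρ
extend-sub0 ρ t zero    = refl
extend-sub0 ρ t (suc i) = refl

force-ren : ∀ A {w} {ρ′ σ ρ : ℕ → ℕ} → ρ′ ∘ σ ≗ ρ → force w ρ′ (ren σ A) ⟺ force w ρ A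
force-ren (atom p ts) {w} h = mk⇔ (subst (All (_< w)) eq) (subst (All (_< w)) (sym eq))
  where eq = trans (sym (map-∘ ts)) (map-cong h ts)
force-ren ⊥'       h = mk⇔ id id
force-ren (A ∧' B) h = mk⇔ (Product.map (to (force-ren A h)) (to (force-ren B h)))
                           (Product.map (from (force-ren A h)) (from (force-ren B h)))
force-ren (A ∨' B) h = mk⇔ (Sum.map (to (force-ren A h)) (to (force-ren B h)))
                           (Sum.map (from (force-ren A h)) (from (force-ren B h)))
force-ren (A ⇒ B)  h = mk⇔ (λ f v w≤v a → to (force-ren B h) (f v w≤v (from (force-ren A h) a)))
                           (λ f v w≤v a → from (force-ren B h) (f v w≤v (to (force-ren A h) a)))
force-ren (∀' A)   h = mk⇔ (λ f v w≤v d → to (force-ren A (extend-lift h)) (f v w≤v d))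
                           (λ f v w≤v d → from (force-ren A (extend-lift h)) (f v w≤v d))
force-ren (∃' A)   h = mk⇔ (Product.map₂ (to (force-ren A (extend-lift h))))
                           (Product.map₂ (from (force-ren A (extend-lift h))))

force-all-mono : ∀ {w v ρ} → w ≤ v → All (force w ρ) Γ → All (force v ρ) Γ
force-all-mono w≤v = All.map (λ {A} → force-mono A w≤v)

force-all-wk : ∀ {w ρ d} → All (force w ρ) Γ → All (force w (extend d ρ)) (map wk Γ)
force-all-wk = All.map⁺ ∘ All.map (λ {A} → from (force-ren A λ _ → refl))

sound : IL ∣ Γ ⊢ A → ∀ w ρ → All (force w ρ) Γ → force w ρ A
sound (hyp x)    w ρ g = All.lookup g x
sound (⊥E d)     w ρ g = ⊥-elim (sound d w ρ g)
sound (∧I d e)   w ρ g = sound d w ρ g , sound e w ρ g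
sound (∧E₁ d)    w ρ g = Product.proj₁ (sound d w ρ g)
sound (∧E₂ d)    w ρ g = Product.proj₂ (sound d w ρ g)
sound (∨I₁ d)    w ρ g = Sum.inj₁ (sound d w ρ g)
sound (∨I₂ d)    w ρ g = Sum.inj₂ (sound d w ρ g)
sound (∨E d e f) w ρ g = [ (λ a → sound e w ρ (a ∷ g)) , (λ b → sound f w ρ (b ∷ g)) ] (sound d w ρ g)
sound (⇒I d)     w ρ g v w≤v a = sound d v ρ (a ∷ force-all-mono w≤v g)
sound (⇒E d e)   w ρ g = sound d w ρ g w ≤-refl (sound e w ρ g)
sound (∀I d)     w ρ g v w≤v e = sound d v (extend e ρ) (force-all-wk (force-all-mono w≤v g))
sound (∀E {A = A} d t) w ρ g =
  from (force-ren A (extend-sub0 ρ t)) (sound d w ρ g w ≤-refl (ρ t))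
sound (∃I {A = A} t d) w ρ g = ρ t , to (force-ren A (extend-sub0 ρ t)) (sound d w ρ g)
sound {A = C} (∃E d e) w ρ g =
  let (e₀ , a) = sound d w ρ g
  in to (force-ren C λ _ → refl) (sound e w (extend e₀ ρ) (a ∷ force-all-wk g))

P₀ : Fm
P₀ = atom 0 (0 ∷ [])

F₀ : Fm
F₀ = ∀' (¬' (¬' P₀)) ∧' ¬' (∀' P₀)

CL-refutes-F₀ : CL ⊢ ¬' F₀
CL-refutes-F₀ = ⇒I (⇒E (∧E₂ #0) (∀I (raa (⇒E (∀E (∧E₁ #1) 0) #0))))

F₀-forced : ∀ ρ → force 0 ρ F₀
F₀-forced ρ = (λ v _ d u _ ¬Pd → ¬Pd (u + suc d) (m≤m+n u (suc d)) (m≤n+m (suc d) u ∷ []))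
            , (λ v _ ∀P → <-irrefl refl (All.head (∀P v ≤-refl v)))

IL-not-refutes-F₀ : ¬ (IL ⊢ ¬' F₀)
IL-not-refutes-F₀ d = sound d 0 id [] 0 ≤-refl (F₀-forced id)

lemma1 : (Σ Fm λ F → (CL ⊢ ¬' F) × ¬ (IL ⊢ ¬' F))
         × ((F : Fm) → CL ⊢ ¬' F → ¬ (IL ⊢ ¬' F)
            → ¬ (Σ Fm λ B → NF B × (IL ⊢ (F ⇔ B))))
lemma1 = (F₀ , CL-refutes-F₀ , IL-not-refutes-F₀)
       , λ F clF ¬ilF (B , nfB , F⇔B) →
           ¬ilF (contrapose (∧E₁ F⇔B)
                  (CL-refutable-NF-is-IL-refutable nfB
                    (contrapose (IL-to-CL (∧E₂ F⇔B)) clF)))
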